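{- Let $k\le n/2$ be positive integers. In an $n$-vertex graph with maximum degree at most $n/k$, a uniformly random $k$-element subset of the vertices contains an independent set of size at least $k/4$ with probability at least $1-e^{ -k/8}$. -}

module Defs where

open import Data.Bool using (Bool; true; false)
open import Data.Nat using (ℕ; zero; suc; _+_; _*_; _^_; _≤_; _!)
open import Data.Nat.Combinatorics using (_C_)
open import Data.Fin using (Fin)
open import Data.Fin.Subset using (Subset; _∈_; _⊆_; ∣_∣)
open import Data.Vec using (tabulate)
open import Data.Product using (∃; _×_)
open import Data.List using (List)
open import Data.List.Relation.Unary.All using (All)
open import Data.List.Relation.Unary.Unique.Propositional using (Unique)
open import Relation.Binary.PropositionalEquality using (_≡_)
open import Relation.Nullary using (¬_)

record Graph (n : ℕ) : Set where
  field
    Adj   : Fin n → Fin n → Bool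
    sym   : ∀ u v → Adj u v ≡ Adj v u
    irrefl : ∀ v → Adj v v ≡ false

open Graph public

nbhd : ∀ {n} → Graph n → Fin n → Subset n
nbhd G v = tabulate (Adj G v)

degree : ∀ {n} → Graph n → Fin n → ℕ
degree G v = ∣ nbhd G v ∣

Independent : ∀ {n} → Graph n → Subset n → Set
Independent G I = ∀ u v → u ∈ I → v ∈ I → Adj G u v ≡ false

ContainsIndepQuarter : ∀ {n} → Graph n → ℕ → Subset n → Set
ContainsIndepQuarter G k S =
  ∃ λ I → I ⊆ S × Independent G I × k ≤ 4 * ∣ I ∣

-- expScaled k m = m! · Σ_{j=0}^{m} k^j / j!   (so expScaled k m / m! ↑ e^k)
expScaled : ℕ → ℕ → ℕ
expScaled k zero = 1
expScaled k (suc m) = suc m * expScaled k m + k ^ suc m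

-- "B / T ≤ e^{-k/8}"  ⇔  B^8 · e^k ≤ T^8
--                     ⇔  ∀ m, B^8 · (Σ_{j≤m} k^j/j!) ≤ T^8
ProbBoundExp : (B T k : ℕ) → Set
ProbBoundExp B T k = ∀ m → B ^ 8 * expScaled k m ≤ T ^ 8 * m !

BadSubset : ∀ {n} → Graph n → ℕ → Subset n → Set
BadSubset G k S = ∣ S ∣ ≡ k × ¬ ContainsIndepQuarter G k S

-- Feed ordered k-sequences of distinct vertices through a greedy procedure
-- that maintains an independent set I: while 4|I| < k, a vertex with a
-- neighbour in I is blocked and weighs 3, and any other vertex joins I.  The
-- degree bound leaves fewer than n/4 blocked vertices while at least n/2 are
-- still available, so each step multiplies the total weight by at most twice
-- the number of available vertices: all sequences weigh at most 2^k k! C(n,k).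
-- An ordering of a bad k-set keeps I inside that set, so at most k/4 of its
-- vertices join I and it weighs at least 3^(3k/4).  Hence
-- |L| 3^k ≤ 3^(k/4) 2^k C(n,k), whose eighth power gives
-- |L|^8 3^(6k) ≤ 2^(8k) C(n,k)^8, and 2^8 e ≤ 3^6 turns this into the bound
-- e^(-k/8); this survives replacing e by (12/11)^12, which bounds the partial
-- sums of its series.

module Submission where

open import Data.Bool using (Bool; true; false; _∧_; not; if_then_else_)
open import Data.Bool.Properties using (T-≡)
open import Data.Fin using (Fin; _≟_)
import Data.Fin as Fin
open import Data.Fin.Subset using (Subset; _∈_; _∉_; _⊆_; _∪_; ⊥; ⊤; ∣_∣)
open import Data.Fin.Subset.Properties using (∉⊥; ⊆⊤; ∣⊥∣≡0; ∣⊤∣≡n; p⊆p∪q; x∈p∪q⁻; x∈p∪q⁺)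
open import Data.List using (List; []; _∷_; length)
open import Data.List.Relation.Unary.All using (All; []; _∷_)
import Data.List.Relation.Unary.All as All
open import Data.List.Relation.Unary.AllPairs using ([]; _∷_)
open import Data.List.Relation.Unary.Unique.Propositional using (Unique)
open import Data.Nat using (ℕ; zero; suc; pred; _+_; _*_; _^_; _!; _≤_; _<_; _<ᵇ_; z≤n; s≤s; s≤s⁻¹; NonZero)
open import Data.Nat.Combinatorics using (_C_; nC1≡n; nCn≡1; nCk≡nC[n∸k]; nCk+nC[k+1]≡[n+1]C[k+1])
open import Data.Nat.DivMod using (_/_; m*n/n≡m; m/n*n≤m; /-monoˡ-≤)
open import Data.Nat.Properties hiding (_≟_)
open import Data.Nat.Tactic.RingSolver using (solve-∀)
open import Data.Product using (_×_; _,_; proj₁; proj₂)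
open import Data.Sum using (_⊎_; inj₁; inj₂)
open import Data.Unit using (tt)
open import Data.Vec using (Vec; []; _∷_; lookup; _[_]≔_)
open import Data.Vec.Properties
  using ([]≔-minimal; ∷-injectiveˡ; ∷-injectiveʳ; lookup∘tabulate; lookup∘update; lookup∘update′; []=⇒lookup; lookup⇒[]=)
open import Defs hiding (sym)
open import Function using (_∘_; Equivalence)
open import Relation.Binary.PropositionalEquality hiding ([_])
open import Relation.Nullary using (yes; no; contradiction)

open import Algebra.Properties.CommutativeSemigroup *-commutativeSemigroup using (x∙yz≈y∙xz)
open import Algebra.Properties.Semiring.Sum +-*-semiring
  using (sum; sum-syntax; sum-cong-≗; sum-replicate-zero; ∑-distrib-+; ∑-comm; *-distribˡ-sum; *-distribʳ-sum)

χ : Bool → ℕ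
χ true  = 1
χ false = 0

χ[0<ᵇm]≤m : ∀ m → χ (0 <ᵇ m) ≤ m
χ[0<ᵇm]≤m zero    = z≤n
χ[0<ᵇm]≤m (suc m) = s≤s z≤n

χ*-mono-≤ : ∀ b {x y} → (b ≡ true → x ≤ y) → χ b * x ≤ χ b * y
χ*-mono-≤ true  x≤y = *-monoʳ-≤ 1 (x≤y refl)
χ*-mono-≤ false _   = z≤n

sum-mono-≤ : ∀ {m} {f g : Fin m → ℕ} → (∀ i → f i ≤ g i) → sum f ≤ sum g
sum-mono-≤ {zero}  f≤g = z≤n
sum-mono-≤ {suc m} f≤g = +-mono-≤ (f≤g Fin.zero) (sum-mono-≤ (f≤g ∘ Fin.suc))

sum≡0⇒≡0 : ∀ {m} (f : Fin m → ℕ) → sum f ≡ 0 → ∀ i → f i ≡ 0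
sum≡0⇒≡0 f ∑f≡0 Fin.zero    = m+n≡0⇒m≡0 (f Fin.zero) ∑f≡0
sum≡0⇒≡0 f ∑f≡0 (Fin.suc i) = sum≡0⇒≡0 (f ∘ Fin.suc) (m+n≡0⇒n≡0 (f Fin.zero) ∑f≡0) i

∣x∷p∣≡χx+∣p∣ : ∀ {m} x (p : Subset m) → ∣ x ∷ p ∣ ≡ χ x + ∣ p ∣
∣x∷p∣≡χx+∣p∣ true  p = refl
∣x∷p∣≡χx+∣p∣ false p = refl

∣p∣≡∑χ : ∀ {m} (p : Subset m) → ∣ p ∣ ≡ ∑[ i < m ] χ (lookup p i)
∣p∣≡∑χ []      = refl
∣p∣≡∑χ (x ∷ p) = trans (∣x∷p∣≡χx+∣p∣ x p) (cong (χ x +_) (∣p∣≡∑χ p))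

∣p[i]≔b∣+χ≡∣p∣+χ : ∀ {m} (p : Subset m) i b → ∣ p [ i ]≔ b ∣ + χ (lookup p i) ≡ ∣ p ∣ + χ b
∣p[i]≔b∣+χ≡∣p∣+χ (x ∷ p) Fin.zero b = begin
  ∣ b ∷ p ∣ + χ x   ≡⟨ cong (_+ χ x) (∣x∷p∣≡χx+∣p∣ b p) ⟩
  χ b + ∣ p ∣ + χ x ≡⟨ exchange (χ b) ∣ p ∣ (χ x) ⟩
  χ x + ∣ p ∣ + χ b ≡⟨ cong (_+ χ b) (∣x∷p∣≡χx+∣p∣ x p) ⟨
  ∣ x ∷ p ∣ + χ b   ∎
  where
  open ≡-Reasoning
  exchange : ∀ a b c → a + b + c ≡ c + b + a
  exchange = solve-∀
∣p[i]≔b∣+χ≡∣p∣+χ (x ∷ p) (Fin.suc i) b = begin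
  ∣ x ∷ p [ i ]≔ b ∣ + χ (lookup p i)     ≡⟨ cong (_+ χ (lookup p i)) (∣x∷p∣≡χx+∣p∣ x (p [ i ]≔ b)) ⟩
  χ x + ∣ p [ i ]≔ b ∣ + χ (lookup p i)   ≡⟨ +-assoc (χ x) _ _ ⟩
  χ x + (∣ p [ i ]≔ b ∣ + χ (lookup p i)) ≡⟨ cong (χ x +_) (∣p[i]≔b∣+χ≡∣p∣+χ p i b) ⟩
  χ x + (∣ p ∣ + χ b)                     ≡⟨ +-assoc (χ x) _ _ ⟨
  χ x + ∣ p ∣ + χ b                       ≡⟨ cong (_+ χ b) (∣x∷p∣≡χx+∣p∣ x p) ⟨
  ∣ x ∷ p ∣ + χ b                         ∎
  where open ≡-Reasoning

1+∣p[i]≔false∣≡∣p∣ : ∀ {m} (p : Subset m) i → lookup p i ≡ true → suc ∣ p [ i ]≔ false ∣ ≡ ∣ p ∣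
1+∣p[i]≔false∣≡∣p∣ p i i∈p = begin
  suc ∣ p [ i ]≔ false ∣              ≡⟨ +-comm 1 _ ⟩
  ∣ p [ i ]≔ false ∣ + 1              ≡⟨ cong (λ b → ∣ p [ i ]≔ false ∣ + χ b) i∈p ⟨
  ∣ p [ i ]≔ false ∣ + χ (lookup p i) ≡⟨ ∣p[i]≔b∣+χ≡∣p∣+χ p i false ⟩
  ∣ p ∣ + 0                           ≡⟨ +-identityʳ ∣ p ∣ ⟩
  ∣ p ∣                               ∎
  where open ≡-Reasoning

∣p[i]≔true∣≡1+∣p∣ : ∀ {m} (p : Subset m) i → lookup p i ≡ false → ∣ p [ i ]≔ true ∣ ≡ suc ∣ p ∣
∣p[i]≔true∣≡1+∣p∣ p i i∉p = begin
  ∣ p [ i ]≔ true ∣                   ≡⟨ +-identityʳ _ ⟨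
  ∣ p [ i ]≔ true ∣ + 0               ≡⟨ cong (λ b → ∣ p [ i ]≔ true ∣ + χ b) i∉p ⟨
  ∣ p [ i ]≔ true ∣ + χ (lookup p i)  ≡⟨ ∣p[i]≔b∣+χ≡∣p∣+χ p i true ⟩
  ∣ p ∣ + 1                           ≡⟨ +-comm ∣ p ∣ 1 ⟩
  suc ∣ p ∣                           ∎
  where open ≡-Reasoning

∣p∣≡0⇒p≡⊥ : ∀ {m} (p : Subset m) → ∣ p ∣ ≡ 0 → p ≡ ⊥
∣p∣≡0⇒p≡⊥ []          _   = refl
∣p∣≡0⇒p≡⊥ (false ∷ p) ∣p∣≡0 = cong (false ∷_) (∣p∣≡0⇒p≡⊥ p ∣p∣≡0)

∈-[]≔⁻ : ∀ {m} {p : Subset m} {i x b} → x ∈ p [ i ]≔ b → x ≡ i ⊎ x ∈ p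
∈-[]≔⁻ {p = p} {i} {x} {b} x∈p[i]≔b with x ≟ i
... | yes x≡i = inj₁ x≡i
... | no  x≢i = inj₂ (lookup⇒[]= x p (trans (sym (lookup∘update′ x≢i p b)) ([]=⇒lookup x∈p[i]≔b)))

i∉p[i]≔false : ∀ {m} (p : Subset m) i → i ∉ p [ i ]≔ false
i∉p[i]≔false p i i∈ = contradiction (trans (sym ([]=⇒lookup i∈)) (lookup∘update i p false)) λ ()

∈-[]≔false⁻ : ∀ {m} {p : Subset m} {i x} → x ∈ p [ i ]≔ false → x ≢ i × x ∈ p
∈-[]≔false⁻ {p = p} {i} x∈ with ∈-[]≔⁻ x∈
... | inj₁ refl = contradiction x∈ (i∉p[i]≔false p i)
... | inj₂ x∈p  = (λ { refl → i∉p[i]≔false p i x∈ }) , x∈p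

∉⇒lookup≡false : ∀ {m} {p : Subset m} {x} → x ∉ p → lookup p x ≡ false
∉⇒lookup≡false {p = p} {x} x∉p with lookup p x in eq
... | true  = contradiction (lookup⇒[]= x p eq) x∉p
... | false = refl

[]≔-injective : ∀ {a} {A : Set a} {m} (xs ys : Vec A m) i {y} →
  lookup xs i ≡ lookup ys i → xs [ i ]≔ y ≡ ys [ i ]≔ y → xs ≡ ys
[]≔-injective (x ∷ xs) (y ∷ ys) Fin.zero    x≡y   eq = cong₂ _∷_ x≡y (∷-injectiveʳ eq)
[]≔-injective (x ∷ xs) (y ∷ ys) (Fin.suc i) xᵢ≡yᵢ eq =
  cong₂ _∷_ (∷-injectiveˡ eq) ([]≔-injective xs ys i xᵢ≡yᵢ (∷-injectiveʳ eq))

-- the link of v in L, in the sense of simplicial complexes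
link : ∀ {m} → Fin m → List (Subset m) → List (Subset m)
link v []      = []
link v (S ∷ L) = if lookup S v then S [ v ]≔ false ∷ link v L else link v L

length-link : ∀ {m} v S (L : List (Subset m)) → length (link v (S ∷ L)) ≡ χ (lookup S v) + length (link v L)
length-link v S L with lookup S v
... | true  = refl
... | false = refl

All-link : ∀ {m} {P Q : Subset m → Set} v {L} →
  (∀ {S} → P S → lookup S v ≡ true → Q (S [ v ]≔ false)) → All P L → All Q (link v L)
All-link v f []                      = []
All-link v f (_∷_ {x = S} pS pL) with lookup S v in S∋v
... | true  = f pS S∋v ∷ All-link v f pL
... | false = All-link v f pL

Unique-link : ∀ {m} v {L : List (Subset m)} → Unique L → Unique (link v L)
Unique-link v []                           = []
Unique-link v {S ∷ L} (S∉L ∷ unique) with lookup S v in S∋v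
... | true  = All-link v (λ S≢S′ S′∋v eq → S≢S′ ([]≔-injective S _ v (trans S∋v (sym S′∋v)) eq)) S∉L
            ∷ Unique-link v unique
... | false = Unique-link v unique

∑χ*length-link : ∀ {m} r (P : Subset m) L → All (λ S → ∣ S ∣ ≡ r × S ⊆ P) L →
  ∑[ v < m ] (χ (lookup P v) * length (link v L)) ≡ r * length L
∑χ*length-link {m} r P [] [] = begin
  ∑[ v < m ] (χ (lookup P v) * 0)   ≡⟨ *-distribʳ-sum 0 (χ ∘ lookup P) ⟨
  ∑[ v < m ] χ (lookup P v) * 0     ≡⟨ *-zeroʳ (∑[ v < m ] χ (lookup P v)) ⟩
  0                                 ≡⟨ *-zeroʳ r ⟨
  r * 0                             ∎
  where open ≡-Reasoning
∑χ*length-link {m} r P (S ∷ L) ((∣S∣≡r , S⊆P) ∷ all) = begin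
  ∑[ v < m ] (χ (lookup P v) * length (link v (S ∷ L)))
    ≡⟨ sum-cong-≗ (λ v → trans (cong (χ (lookup P v) *_) (length-link v S L)) (*-distribˡ-+ (χ (lookup P v)) _ _)) ⟩
  ∑[ v < m ] (χ (lookup P v) * χ (lookup S v) + χ (lookup P v) * length (link v L))
    ≡⟨ ∑-distrib-+ (λ v → χ (lookup P v) * χ (lookup S v)) (λ v → χ (lookup P v) * length (link v L)) ⟩
  ∑[ v < m ] (χ (lookup P v) * χ (lookup S v)) + ∑[ v < m ] (χ (lookup P v) * length (link v L))
    ≡⟨ cong₂ _+_ (sum-cong-≗ (λ v → χ-⊆ (lookup P v) (lookup S v) (S∋v⇒P∋v v))) (∑χ*length-link r P L all) ⟩
  ∑[ v < m ] χ (lookup S v) + r * length L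
    ≡⟨ cong (_+ r * length L) (trans (sym (∣p∣≡∑χ S)) ∣S∣≡r) ⟩
  r + r * length L
    ≡⟨ *-suc r (length L) ⟨
  r * suc (length L) ∎
  where
  open ≡-Reasoning
  χ-⊆ : ∀ a b → (b ≡ true → a ≡ true) → χ a * χ b ≡ χ b
  χ-⊆ a     false _   = *-zeroʳ (χ a)
  χ-⊆ a     true  b⇒a rewrite b⇒a refl = refl
  S∋v⇒P∋v : ∀ v → lookup S v ≡ true → lookup P v ≡ true
  S∋v⇒P∋v v v∈S = []=⇒lookup (S⊆P (lookup⇒[]= v S v∈S))

degree≡∑χAdj : ∀ {n} (G : Graph n) u → degree G u ≡ ∑[ v < n ] χ (Adj G u v)
degree≡∑χAdj G u = trans (∣p∣≡∑χ (nbhd G u)) (sum-cong-≗ (cong χ ∘ lookup∘tabulate (Adj G u)))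

Independent-[]≔true : ∀ {n} (G : Graph n) {I v} → Independent G I →
  (∀ u → u ∈ I → Adj G u v ≡ false) → Independent G (I [ v ]≔ true)
Independent-[]≔true G {I} {v} indep v≁I u w u∈ w∈ with ∈-[]≔⁻ u∈ | ∈-[]≔⁻ w∈
... | inj₂ u∈I | inj₂ w∈I = indep u w u∈I w∈I
... | inj₂ u∈I | inj₁ refl = v≁I u u∈I
... | inj₁ refl | inj₂ w∈I = trans (Graph.sym G v w) (v≁I w w∈I)
... | inj₁ refl | inj₁ refl = irrefl G v

-- Binomial coefficients and the exponential series

nC0≡1 : ∀ n → n C 0 ≡ 1
nC0≡1 n = trans (nCk≡nC[n∸k] {0} {n} z≤n) (nCn≡1 n)

[n+1]*nCk≡[k+1]*[n+1]C[k+1] : ∀ n k → suc n * (n C k) ≡ suc k * (suc n C suc k)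
[n+1]*nCk≡[k+1]*[n+1]C[k+1] n       zero    = begin
  suc n * (n C 0)   ≡⟨ cong (suc n *_) (nC0≡1 n) ⟩
  suc n * 1         ≡⟨ *-identityʳ (suc n) ⟩
  suc n             ≡⟨ nC1≡n (suc n) ⟨
  suc n C 1         ≡⟨ *-identityˡ (suc n C 1) ⟨
  1 * (suc n C 1)   ∎
  where open ≡-Reasoning
[n+1]*nCk≡[k+1]*[n+1]C[k+1] zero    (suc k) = sym (*-zeroʳ (suc (suc k)))
[n+1]*nCk≡[k+1]*[n+1]C[k+1] (suc n) (suc k) = begin
  suc (suc n) * (suc n C suc k)          ≡⟨ cong (suc (suc n) *_) pascal ⟨
  suc (suc n) * (a + b)                  ≡⟨ expand n a b ⟩
  suc n * a + suc n * b + (a + b)        ≡⟨ cong₂ (λ x y → x + y + (a + b)) ih₁ ih₂ ⟩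
  suc k * (a + b) + suc (suc k) * c + (a + b) ≡⟨ collect k a b c ⟩
  suc (suc k) * ((a + b) + c)            ≡⟨ cong (λ x → suc (suc k) * (x + c)) pascal ⟩
  suc (suc k) * (suc n C suc k + c)       ≡⟨ cong (suc (suc k) *_) (nCk+nC[k+1]≡[n+1]C[k+1] (suc n) (suc k)) ⟩
  suc (suc k) * (suc (suc n) C suc (suc k)) ∎
  where
  open ≡-Reasoning
  a = n C k
  b = n C suc k
  c = suc n C suc (suc k)
  pascal : a + b ≡ suc n C suc k
  pascal = nCk+nC[k+1]≡[n+1]C[k+1] n k
  ih₁ : suc n * a ≡ suc k * (a + b)
  ih₁ = trans ([n+1]*nCk≡[k+1]*[n+1]C[k+1] n k) (cong (suc k *_) (sym pascal))
  ih₂ : suc n * b ≡ suc (suc k) * c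
  ih₂ = [n+1]*nCk≡[k+1]*[n+1]C[k+1] n (suc k)
  expand : ∀ n a b → suc (suc n) * (a + b) ≡ suc n * a + suc n * b + (a + b)
  expand = solve-∀
  collect : ∀ k a b c → suc k * (a + b) + suc (suc k) * c + (a + b) ≡ suc (suc k) * ((a + b) + c)
  collect = solve-∀

2p*2^r*r!*[p-1]Cr≤2^[r+1]*[r+1]!*pC[r+1] : ∀ p r →
  2 * p * (2 ^ r * (r ! * (pred p C r))) ≤ 2 ^ suc r * (suc r ! * (p C suc r))
2p*2^r*r!*[p-1]Cr≤2^[r+1]*[r+1]!*pC[r+1] zero    r = z≤n
2p*2^r*r!*[p-1]Cr≤2^[r+1]*[r+1]!*pC[r+1] (suc q) r = ≤-reflexive (begin
  2 * suc q * (2 ^ r * (r ! * (q C r)))        ≡⟨ regroup (suc q) (2 ^ r) (r !) (q C r) ⟩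
  2 * 2 ^ r * (r ! * (suc q * (q C r)))        ≡⟨ cong (λ x → 2 * 2 ^ r * (r ! * x)) ([n+1]*nCk≡[k+1]*[n+1]C[k+1] q r) ⟩
  2 * 2 ^ r * (r ! * (suc r * (suc q C suc r))) ≡⟨ regroup′ (suc r) (2 ^ r) (r !) (suc q C suc r) ⟩
  2 * 2 ^ r * (suc r * r ! * (suc q C suc r))   ∎)
  where
  open ≡-Reasoning
  regroup : ∀ p x f c → 2 * p * (x * (f * c)) ≡ 2 * x * (f * (p * c))
  regroup = solve-∀
  regroup′ : ∀ s x f c → 2 * x * (f * (s * c)) ≡ 2 * x * (s * f * c)
  regroup′ = solve-∀

^-distribʳ-* : ∀ a b j → (a * b) ^ j ≡ a ^ j * b ^ j
^-distribʳ-* a b zero    = refl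
^-distribʳ-* a b (suc j) = trans (cong (a * b *_) (^-distribʳ-* a b j)) (interchange a b (a ^ j) (b ^ j))
  where
  interchange : ∀ a b x y → a * b * (x * y) ≡ a * x * (b * y)
  interchange = solve-∀

[a^b]^c≡[a^c]^b : ∀ a b c → (a ^ b) ^ c ≡ (a ^ c) ^ b
[a^b]^c≡[a^c]^b a b c = trans (^-*-assoc a b c) (trans (cong (a ^_) (*-comm b c)) (sym (^-*-assoc a c b)))

[1+a]^[1+j]≤a^[1+j]+[1+j]*[1+a]^j : ∀ a j → suc a ^ suc j ≤ a ^ suc j + suc j * suc a ^ j
[1+a]^[1+j]≤a^[1+j]+[1+j]*[1+a]^j a zero    = ≤-reflexive (base a)
  where
  base : ∀ a → suc a * 1 ≡ a * 1 + 1 * 1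
  base = solve-∀
[1+a]^[1+j]≤a^[1+j]+[1+j]*[1+a]^j a (suc j) = begin
  suc a * suc a ^ suc j
    ≤⟨ *-monoʳ-≤ (suc a) ([1+a]^[1+j]≤a^[1+j]+[1+j]*[1+a]^j a j) ⟩
  suc a * (a ^ suc j + suc j * suc a ^ j)
    ≡⟨ expand a j (a ^ suc j) (suc a ^ j) ⟩
  a * a ^ suc j + a ^ suc j + suc j * (suc a * suc a ^ j)
    ≤⟨ +-monoˡ-≤ _ (+-monoʳ-≤ (a * a ^ suc j) (^-monoˡ-≤ (suc j) (n≤1+n a))) ⟩
  a * a ^ suc j + suc a ^ suc j + suc j * (suc a * suc a ^ j)
    ≡⟨ collect (a * a ^ suc j) (suc a * suc a ^ j) j ⟩
  a * a ^ suc j + suc (suc j) * suc a ^ suc j ∎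
  where
  open ≤-Reasoning
  expand : ∀ a j x y → suc a * (x + suc j * y) ≡ a * x + x + suc j * (suc a * y)
  expand = solve-∀
  collect : ∀ x y j → x + y + suc j * y ≡ x + suc (suc j) * y
  collect = solve-∀

-- scaledExp c a m = m! · Σ_{j ≤ m} a^j c^(m-j) / j!, that is m! c^m times the
-- m-th partial sum of the series of e^(a/c).
scaledExp : ℕ → ℕ → ℕ → ℕ
scaledExp c a zero    = 1
scaledExp c a (suc m) = suc m * c * scaledExp c a m + a ^ suc m

scaledExp-*-expScaled : ∀ c k m → scaledExp c (c * k) m ≡ c ^ m * expScaled k m
scaledExp-*-expScaled c k zero    = refl
scaledExp-*-expScaled c k (suc m) = begin
  suc m * c * scaledExp c (c * k) m + (c * k) ^ suc m
    ≡⟨ cong₂ (λ x y → suc m * c * x + y) (scaledExp-*-expScaled c k m) (^-distribʳ-* c k (suc m)) ⟩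
  suc m * c * (c ^ m * expScaled k m) + c ^ suc m * k ^ suc m
    ≡⟨ factor (suc m) (c ^ m) (expScaled k m) (k ^ suc m) c ⟩
  c ^ suc m * (suc m * expScaled k m + k ^ suc m) ∎
  where
  open ≡-Reasoning
  factor : ∀ s x e y c → s * c * (x * e) + c * x * y ≡ c * x * (s * e + y)
  factor = solve-∀

scaledExp-zero : ∀ c m → scaledExp c 0 m ≡ c ^ m * m !
scaledExp-zero c zero    = refl
scaledExp-zero c (suc m) = trans (cong (λ x → suc m * c * x + 0) (scaledExp-zero c m)) (factor (suc m) c (c ^ m) (m !))
  where
  factor : ∀ s c x f → s * c * (x * f) + 0 ≡ c * x * (s * f)
  factor = solve-∀

scaledExp-suc-≤ : ∀ c a m →
  scaledExp c (suc a) (suc m) ≤ scaledExp c a (suc m) + suc m * scaledExp c (suc a) m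
scaledExp-suc-≤ c a zero    = ≤-reflexive (base c a)
  where
  base : ∀ c a → 1 * c * 1 + suc a * 1 ≡ 1 * c * 1 + a * 1 + 1 * 1
  base = solve-∀
scaledExp-suc-≤ c a (suc m) = begin
  suc (suc m) * c * scaledExp c (suc a) (suc m) + suc a ^ suc (suc m)
    ≤⟨ +-mono-≤ (*-monoʳ-≤ (suc (suc m) * c) (scaledExp-suc-≤ c a m))
                ([1+a]^[1+j]≤a^[1+j]+[1+j]*[1+a]^j a (suc m)) ⟩
  suc (suc m) * c * (x + suc m * y) + (z + suc (suc m) * u)
    ≡⟨ regroup m c x y z u ⟩
  suc (suc m) * c * x + z + suc (suc m) * (suc m * c * y + u) ∎
  where
  open ≤-Reasoning
  x = scaledExp c a (suc m)
  y = scaledExp c (suc a) m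
  z = a ^ suc (suc m)
  u = suc a ^ suc m
  regroup : ∀ m c x y z u →
    suc (suc m) * c * (x + suc m * y) + (z + suc (suc m) * u) ≡
    suc (suc m) * c * x + z + suc (suc m) * (suc m * c * y + u)
  regroup = solve-∀

-- the partial-sum form of e^(1/(c+1)) ≤ (c+1)/c
scaledExp-suc-ratio : ∀ c a m → c * scaledExp (suc c) (suc a) m ≤ suc c * scaledExp (suc c) a m
scaledExp-suc-ratio c a zero    = *-monoˡ-≤ 1 (n≤1+n c)
scaledExp-suc-ratio c a (suc m) = +-cancelˡ-≤ x (c * x) (suc c * scaledExp (suc c) a (suc m)) (begin
  suc c * x
    ≤⟨ *-monoʳ-≤ (suc c) (scaledExp-suc-≤ (suc c) a m) ⟩
  suc c * (scaledExp (suc c) a (suc m) + suc m * y)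
    ≡⟨ *-distribˡ-+ (suc c) (scaledExp (suc c) a (suc m)) (suc m * y) ⟩
  suc c * scaledExp (suc c) a (suc m) + suc c * (suc m * y)
    ≤⟨ +-monoʳ-≤ (suc c * scaledExp (suc c) a (suc m))
         (≤-trans (≤-reflexive (reassoc (suc c) (suc m) y)) (m≤m+n (suc m * suc c * y) (suc a ^ suc m))) ⟩
  suc c * scaledExp (suc c) a (suc m) + x
    ≡⟨ +-comm _ x ⟩
  x + suc c * scaledExp (suc c) a (suc m) ∎)
  where
  open ≤-Reasoning
  x = scaledExp (suc c) (suc a) (suc m)
  y = scaledExp (suc c) (suc a) m
  reassoc : ∀ c s y → c * (s * y) ≡ s * c * y
  reassoc = solve-∀

scaledExp-^-ratio : ∀ c a m → c ^ a * scaledExp (suc c) a m ≤ suc c ^ a * scaledExp (suc c) 0 m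
scaledExp-^-ratio c zero    m = ≤-refl
scaledExp-^-ratio c (suc a) m = begin
  c * c ^ a * x                   ≡⟨ *-assoc c (c ^ a) x ⟩
  c * (c ^ a * x)                 ≡⟨ x∙yz≈y∙xz c (c ^ a) x ⟩
  c ^ a * (c * x)                 ≤⟨ *-monoʳ-≤ (c ^ a) (scaledExp-suc-ratio c a m) ⟩
  c ^ a * (suc c * y)             ≡⟨ x∙yz≈y∙xz (c ^ a) (suc c) y ⟩
  suc c * (c ^ a * y)             ≤⟨ *-monoʳ-≤ (suc c) (scaledExp-^-ratio c a m) ⟩
  suc c * (suc c ^ a * z)         ≡⟨ *-assoc (suc c) (suc c ^ a) z ⟨
  suc c * suc c ^ a * z           ∎
  where
  open ≤-Reasoning
  x = scaledExp (suc c) (suc a) m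
  y = scaledExp (suc c) a m
  z = scaledExp (suc c) 0 m

expScaled-bound : ∀ c k m → c ^ (suc c * k) * expScaled k m ≤ suc c ^ (suc c * k) * m !
expScaled-bound c k m = *-cancelˡ-≤ (suc c ^ m) {{m^n≢0 (suc c) m}} (begin
  d ^ m * (c ^ e * expScaled k m)    ≡⟨ x∙yz≈y∙xz (d ^ m) (c ^ e) _ ⟩
  c ^ e * (d ^ m * expScaled k m)    ≡⟨ cong (c ^ e *_) (scaledExp-*-expScaled d k m) ⟨
  c ^ e * scaledExp d (d * k) m      ≤⟨ scaledExp-^-ratio c e m ⟩
  d ^ e * scaledExp d 0 m            ≡⟨ cong (d ^ e *_) (scaledExp-zero d m) ⟩
  d ^ e * (d ^ m * m !)              ≡⟨ x∙yz≈y∙xz (d ^ e) (d ^ m) _ ⟩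
  d ^ m * (d ^ e * m !)              ∎)
  where
  open ≤-Reasoning
  d = suc c
  e = suc c * k

4*j<k⇒j≤k/4 : ∀ {j k} → 4 * j < k → j ≤ k / 4
4*j<k⇒j≤k/4 {j} {k} 4j<k = begin
  j              ≡⟨ m*n/n≡m j 4 ⟨
  j * 4 / 4      ≤⟨ /-monoˡ-≤ 4 (≤-trans (≤-reflexive (*-comm j 4)) (<⇒≤ 4j<k)) ⟩
  k / 4          ∎
  where open ≤-Reasoning

4*s<k∧k*h≤n*s⇒4*h≤n : ∀ {s h k n} → 4 * s < k → k * h ≤ n * s → 4 * h ≤ n
4*s<k∧k*h≤n*s⇒4*h≤n {s} {h} {k@(suc _)} {n} 4s<k kh≤ns = *-cancelˡ-≤ k (begin
  k * (4 * h)  ≡⟨ x∙yz≈y∙xz k 4 h ⟩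
  4 * (k * h)  ≤⟨ *-monoʳ-≤ 4 kh≤ns ⟩
  4 * (n * s)  ≡⟨ x∙yz≈y∙xz 4 n s ⟩
  n * (4 * s)  ≤⟨ *-monoʳ-≤ n (<⇒≤ 4s<k) ⟩
  n * k        ≡⟨ *-comm n k ⟩
  k * n        ∎)
  where open ≤-Reasoning

n+1≤p+k∧2k≤n⇒n≤2p : ∀ {n p k} → n + 1 ≤ p + k → 2 * k ≤ n → n ≤ 2 * p
n+1≤p+k∧2k≤n⇒n≤2p {n} {p} {k} n+1≤p+k 2k≤n = +-cancelʳ-≤ n n (2 * p) (begin
  n + n            ≤⟨ m≤m+n (n + n) 2 ⟩
  n + n + 2        ≡⟨ double n ⟩
  2 * (n + 1)      ≤⟨ *-monoʳ-≤ 2 n+1≤p+k ⟩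
  2 * (p + k)      ≡⟨ *-distribˡ-+ 2 p k ⟩
  2 * p + 2 * k    ≤⟨ +-monoʳ-≤ (2 * p) 2k≤n ⟩
  2 * p + n        ∎)
  where
  open ≤-Reasoning
  double : ∀ n → n + n + 2 ≡ 2 * (n + 1)
  double = solve-∀

cross-multiply-≤ : ∀ {p q r s a b c d} .{{_ : NonZero (a * c)}} →
  p * a ≤ b * q → c * r ≤ d * s → b * d ≤ a * c → p * r ≤ q * s
cross-multiply-≤ {p} {q} {r} {s} {a} {b} {c} {d} pa≤bq cr≤ds bd≤ac = *-cancelʳ-≤ (p * r) (q * s) (a * c) (begin
  p * r * (a * c)   ≡⟨ regroup p r a c ⟩
  p * a * (c * r)   ≤⟨ *-mono-≤ pa≤bq cr≤ds ⟩
  b * q * (d * s)   ≡⟨ regroup′ b q d s ⟩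
  q * s * (b * d)   ≤⟨ *-monoʳ-≤ (q * s) bd≤ac ⟩
  q * s * (a * c)   ∎)
  where
  open ≤-Reasoning
  regroup : ∀ p r a c → p * r * (a * c) ≡ p * a * (c * r)
  regroup = solve-∀
  regroup′ : ∀ b q d s → b * q * (d * s) ≡ q * s * (b * d)
  regroup′ = solve-∀

eighth-power-≤ : ∀ B a q w T .{{_ : NonZero a}} →
  q ^ 4 ≤ a → B * a ≤ q * (w * T) → B ^ 8 * a ^ 6 ≤ w ^ 8 * T ^ 8
eighth-power-≤ B a q w T q⁴≤a Ba≤qwT = begin
  B ^ 8 * a ^ 6                   ≡⟨ cong₂ _*_ (^-*-assoc B 4 2) (^-*-assoc a 3 2) ⟨
  (B ^ 4) ^ 2 * (a ^ 3) ^ 2       ≡⟨ ^-distribʳ-* (B ^ 4) (a ^ 3) 2 ⟨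
  (B ^ 4 * a ^ 3) ^ 2             ≤⟨ ^-monoˡ-≤ 2 B⁴a³≤w⁴T⁴ ⟩
  (w ^ 4 * T ^ 4) ^ 2             ≡⟨ ^-distribʳ-* (w ^ 4) (T ^ 4) 2 ⟩
  (w ^ 4) ^ 2 * (T ^ 4) ^ 2       ≡⟨ cong₂ _*_ (^-*-assoc w 4 2) (^-*-assoc T 4 2) ⟩
  w ^ 8 * T ^ 8                   ∎
  where
  open ≤-Reasoning
  B⁴a³≤w⁴T⁴ : B ^ 4 * a ^ 3 ≤ w ^ 4 * T ^ 4
  B⁴a³≤w⁴T⁴ = *-cancelˡ-≤ a (begin
    a * (B ^ 4 * a ^ 3)           ≡⟨ x∙yz≈y∙xz a (B ^ 4) (a ^ 3) ⟩
    B ^ 4 * a ^ 4                 ≡⟨ ^-distribʳ-* B a 4 ⟨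
    (B * a) ^ 4                   ≤⟨ ^-monoˡ-≤ 4 Ba≤qwT ⟩
    (q * (w * T)) ^ 4             ≡⟨ ^-distribʳ-* q (w * T) 4 ⟩
    q ^ 4 * (w * T) ^ 4           ≡⟨ cong (q ^ 4 *_) (^-distribʳ-* w T 4) ⟩
    q ^ 4 * (w ^ 4 * T ^ 4)       ≤⟨ *-monoˡ-≤ (w ^ 4 * T ^ 4) q⁴≤a ⟩
    a * (w ^ 4 * T ^ 4)           ∎)

[a^[k/4]]^4≤a^k : ∀ a .{{_ : NonZero a}} k → (a ^ (k / 4)) ^ 4 ≤ a ^ k
[a^[k/4]]^4≤a^k a k = ≤-trans (≤-reflexive (^-*-assoc a (k / 4) 4)) (^-monoʳ-≤ a (m/n*n≤m k 4))

-- 2^8 e ≤ 3^6 with e replaced by its upper bound (12/11)^12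
[2^k]^8*12^[12k]≤[3^k]^6*11^[12k] : ∀ k → (2 ^ k) ^ 8 * 12 ^ (12 * k) ≤ (3 ^ k) ^ 6 * 11 ^ (12 * k)
[2^k]^8*12^[12k]≤[3^k]^6*11^[12k] k = begin
  (2 ^ k) ^ 8 * 12 ^ (12 * k)       ≡⟨ cong₂ _*_ ([a^b]^c≡[a^c]^b 2 k 8) (sym (^-*-assoc 12 12 k)) ⟩
  (2 ^ 8) ^ k * (12 ^ 12) ^ k       ≡⟨ ^-distribʳ-* (2 ^ 8) (12 ^ 12) k ⟨
  (2 ^ 8 * 12 ^ 12) ^ k             ≤⟨ ^-monoˡ-≤ k (≤ᵇ⇒≤ (2 ^ 8 * 12 ^ 12) (3 ^ 6 * 11 ^ 12) tt) ⟩
  (3 ^ 6 * 11 ^ 12) ^ k             ≡⟨ ^-distribʳ-* (3 ^ 6) (11 ^ 12) k ⟩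
  (3 ^ 6) ^ k * (11 ^ 12) ^ k       ≡⟨ cong₂ _*_ ([a^b]^c≡[a^c]^b 3 6 k) (^-*-assoc 11 12 k) ⟩
  (3 ^ k) ^ 6 * 11 ^ (12 * k)       ∎
  where open ≤-Reasoning

-- Greedy weights

module Greedy {n : ℕ} (G : Graph n) (k : ℕ) where

  small : Subset n → Bool
  small I = 4 * ∣ I ∣ <ᵇ k

  neighboursIn : Subset n → Fin n → ℕ
  neighboursIn I v = ∑[ u < n ] (χ (lookup I u) * χ (Adj G u v))

  touches : Subset n → Fin n → Bool
  touches I v = 0 <ᵇ neighboursIn I v

  blocked : Subset n → Fin n → Bool
  blocked I v = small I ∧ touches I v

  weight : Subset n → Fin n → ℕ
  weight I v = if blocked I v then 3 else 1

  grow : Subset n → Fin n → Subset n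
  grow I v = if small I ∧ not (touches I v) then I [ v ]≔ true else I

  -- W r P I counts the ordered choices of r distinct vertices of P, processed
  -- greedily from I: while 4∣I∣ < k a vertex with a neighbour in I weighs 3
  -- and any other vertex joins I; once I is that large every vertex weighs 1.
  W : ℕ → Subset n → Subset n → ℕ
  W zero    P I = 1
  W (suc r) P I = ∑[ v < n ] (χ (lookup P v) * (weight I v * W r (P [ v ]≔ false) (grow I v)))

  small⇒4∣I∣<k : ∀ {I} → small I ≡ true → 4 * ∣ I ∣ < k
  small⇒4∣I∣<k {I} = <ᵇ⇒< (4 * ∣ I ∣) k ∘ Equivalence.from T-≡

  4∣I∣<k⇒small : ∀ {I} → 4 * ∣ I ∣ < k → small I ≡ true
  4∣I∣<k⇒small = Equivalence.to T-≡ ∘ <⇒<ᵇ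

  ∑neighboursIn≡∑degree : ∀ I → ∑[ v < n ] neighboursIn I v ≡ ∑[ u < n ] (χ (lookup I u) * degree G u)
  ∑neighboursIn≡∑degree I = begin
    ∑[ v < n ] ∑[ u < n ] (χ (lookup I u) * χ (Adj G u v)) ≡⟨ ∑-comm (λ v u → χ (lookup I u) * χ (Adj G u v)) ⟩
    ∑[ u < n ] ∑[ v < n ] (χ (lookup I u) * χ (Adj G u v)) ≡⟨ sum-cong-≗ (λ u → sym (*-distribˡ-sum (χ (lookup I u)) (χ ∘ Adj G u))) ⟩
    ∑[ u < n ] (χ (lookup I u) * ∑[ v < n ] χ (Adj G u v)) ≡⟨ sum-cong-≗ (λ u → cong (χ (lookup I u) *_) (degree≡∑χAdj G u)) ⟨
    ∑[ u < n ] (χ (lookup I u) * degree G u)              ∎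
    where open ≡-Reasoning

  k*∑neighboursIn≤n*∣I∣ : (∀ v → k * degree G v ≤ n) → ∀ I → k * ∑[ v < n ] neighboursIn I v ≤ n * ∣ I ∣
  k*∑neighboursIn≤n*∣I∣ k*deg≤n I = begin
    k * ∑[ v < n ] neighboursIn I v               ≡⟨ cong (k *_) (∑neighboursIn≡∑degree I) ⟩
    k * ∑[ u < n ] (χ (lookup I u) * degree G u)    ≡⟨ *-distribˡ-sum k (λ u → χ (lookup I u) * degree G u) ⟩
    ∑[ u < n ] (k * (χ (lookup I u) * degree G u))  ≡⟨ sum-cong-≗ (λ u → x∙yz≈y∙xz k (χ (lookup I u)) (degree G u)) ⟩
    ∑[ u < n ] (χ (lookup I u) * (k * degree G u))  ≤⟨ sum-mono-≤ (λ u → *-monoʳ-≤ (χ (lookup I u)) (k*deg≤n u)) ⟩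
    ∑[ u < n ] (χ (lookup I u) * n)                ≡⟨ *-distribʳ-sum n (χ ∘ lookup I) ⟨
    (∑[ u < n ] χ (lookup I u)) * n               ≡⟨ cong (_* n) (∣p∣≡∑χ I) ⟨
    ∣ I ∣ * n                                     ≡⟨ *-comm ∣ I ∣ n ⟩
    n * ∣ I ∣                                     ∎
    where open ≤-Reasoning

  4*∑χblocked≤n : (∀ v → k * degree G v ≤ n) → ∀ I → 4 * ∑[ v < n ] χ (blocked I v) ≤ n
  4*∑χblocked≤n k*deg≤n I with small I in small≡true
  ... | false = ≤-trans (≤-reflexive (cong (4 *_) (sum-replicate-zero n))) z≤n
  ... | true  = 4*s<k∧k*h≤n*s⇒4*h≤n (small⇒4∣I∣<k {I} small≡true)
    (≤-trans (*-monoʳ-≤ k (sum-mono-≤ (χ[0<ᵇm]≤m ∘ neighboursIn I))) (k*∑neighboursIn≤n*∣I∣ k*deg≤n I))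

  ∑χ*weight≤2∣P∣ : 2 * k ≤ n → (∀ v → k * degree G v ≤ n) → ∀ P I → n + 1 ≤ ∣ P ∣ + k →
                   ∑[ v < n ] (χ (lookup P v) * weight I v) ≤ 2 * ∣ P ∣
  ∑χ*weight≤2∣P∣ 2k≤n k*deg≤n P I n+1≤∣P∣+k = begin
    ∑[ v < n ] (χ (lookup P v) * weight I v)             ≤⟨ sum-mono-≤ (λ v → χ*weight≤ (lookup P v) (blocked I v)) ⟩
    ∑[ v < n ] (χ (lookup P v) + 2 * χ (blocked I v))   ≡⟨ ∑-distrib-+ (χ ∘ lookup P) (λ v → 2 * χ (blocked I v)) ⟩
    ∑[ v < n ] χ (lookup P v) + ∑[ v < n ] (2 * χ (blocked I v))
      ≡⟨ cong₂ _+_ (∣p∣≡∑χ P) (*-distribˡ-sum 2 (χ ∘ blocked I)) ⟨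
    ∣ P ∣ + 2 * ∑[ v < n ] χ (blocked I v)              ≤⟨ +-monoʳ-≤ ∣ P ∣ 2*∑χblocked≤∣P∣ ⟩
    ∣ P ∣ + ∣ P ∣                                        ≡⟨ cong (∣ P ∣ +_) (+-identityʳ ∣ P ∣) ⟨
    2 * ∣ P ∣                                            ∎
    where
    open ≤-Reasoning
    χ*weight≤ : ∀ p b → χ p * (if b then 3 else 1) ≤ χ p + 2 * χ b
    χ*weight≤ true  true  = ≤-refl
    χ*weight≤ true  false = ≤-refl
    χ*weight≤ false b     = z≤n
    2*∑χblocked≤∣P∣ : 2 * ∑[ v < n ] χ (blocked I v) ≤ ∣ P ∣
    2*∑χblocked≤∣P∣ = *-cancelˡ-≤ 2 (begin
      2 * (2 * ∑[ v < n ] χ (blocked I v))  ≡⟨ *-assoc 2 2 (∑[ v < n ] χ (blocked I v)) ⟨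
      4 * ∑[ v < n ] χ (blocked I v)        ≤⟨ 4*∑χblocked≤n k*deg≤n I ⟩
      n                                     ≤⟨ n+1≤p+k∧2k≤n⇒n≤2p {n} {∣ P ∣} n+1≤∣P∣+k 2k≤n ⟩
      2 * ∣ P ∣                             ∎)

  W≤2^r*r!*∣P∣Cr : 2 * k ≤ n → (∀ v → k * degree G v ≤ n) →
    ∀ r P I → n + r ≤ ∣ P ∣ + k → W r P I ≤ 2 ^ r * (r ! * (∣ P ∣ C r))
  W≤2^r*r!*∣P∣Cr 2k≤n k*deg≤n zero    P I _ = ≤-reflexive (sym (cong (1 *_) (trans (*-identityˡ _) (nC0≡1 ∣ P ∣))))
  W≤2^r*r!*∣P∣Cr 2k≤n k*deg≤n (suc r) P I n+r+1≤∣P∣+k = begin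
    ∑[ v < n ] (χ (lookup P v) * (weight I v * W r (P [ v ]≔ false) (grow I v)))
      ≤⟨ sum-mono-≤ (λ v → χ*-mono-≤ (lookup P v) (*-monoʳ-≤ (weight I v) ∘ IH v)) ⟩
    ∑[ v < n ] (χ (lookup P v) * (weight I v * X))
      ≡⟨ sum-cong-≗ (λ v → *-assoc (χ (lookup P v)) (weight I v) X) ⟨
    ∑[ v < n ] (χ (lookup P v) * weight I v * X)
      ≡⟨ *-distribʳ-sum X (λ v → χ (lookup P v) * weight I v) ⟨
    ∑[ v < n ] (χ (lookup P v) * weight I v) * X
      ≤⟨ *-monoˡ-≤ X (∑χ*weight≤2∣P∣ 2k≤n k*deg≤n P I (≤-trans (+-monoʳ-≤ n (s≤s z≤n)) n+r+1≤∣P∣+k)) ⟩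
    2 * ∣ P ∣ * X
      ≤⟨ 2p*2^r*r!*[p-1]Cr≤2^[r+1]*[r+1]!*pC[r+1] ∣ P ∣ r ⟩
    2 ^ suc r * (suc r ! * (∣ P ∣ C suc r)) ∎
    where
    open ≤-Reasoning
    X = 2 ^ r * (r ! * (pred ∣ P ∣ C r))
    IH : ∀ v → lookup P v ≡ true → W r (P [ v ]≔ false) (grow I v) ≤ X
    IH v v∈P = subst (λ p → W r (P [ v ]≔ false) (grow I v) ≤ 2 ^ r * (r ! * (p C r)))
      (cong pred (1+∣p[i]≔false∣≡∣p∣ P v v∈P))
      (W≤2^r*r!*∣P∣Cr 2k≤n k*deg≤n r (P [ v ]≔ false) (grow I v)
        (s≤s⁻¹ (subst₂ _≤_ (+-suc n r) (cong (_+ k) (sym (1+∣p[i]≔false∣≡∣p∣ P v v∈P))) n+r+1≤∣P∣+k)))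

  ¬touches⇒nonadjacent : ∀ {I v} → touches I v ≡ false → ∀ u → u ∈ I → Adj G u v ≡ false
  ¬touches⇒nonadjacent {I} {v} ¬touches u u∈I =
    χ*χ≡0 (lookup I u) (Adj G u v) ([]=⇒lookup u∈I) (sum≡0⇒≡0 _ (0<ᵇm≡false⇒m≡0 _ ¬touches) u)
    where
    0<ᵇm≡false⇒m≡0 : ∀ m → (0 <ᵇ m) ≡ false → m ≡ 0
    0<ᵇm≡false⇒m≡0 zero _ = refl
    χ*χ≡0 : ∀ a b → a ≡ true → χ a * χ b ≡ 0 → b ≡ false
    χ*χ≡0 true false _ _ = refl

  grow⊆ : ∀ {I v x} → x ∈ grow I v → x ≡ v ⊎ x ∈ I
  grow⊆ {I} {v} x∈ with small I ∧ not (touches I v)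
  ... | true  = ∈-[]≔⁻ x∈
  ... | false = inj₂ x∈

  grow-independent : ∀ {I} v → Independent G I → Independent G (grow I v)
  grow-independent {I} v indep with small I ∧ not (touches I v) in grows
  ... | true  = Independent-[]≔true G indep (¬touches⇒nonadjacent (∧-not grows))
    where
    ∧-not : ∀ {a b} → a ∧ not b ≡ true → b ≡ false
    ∧-not {true} {false} _ = refl
  ... | false = indep

  3^[1+r+∣I∣]≡weight*3^[r+∣grow∣] : ∀ r {I v} → small I ≡ true → lookup I v ≡ false →
    3 ^ (suc r + ∣ I ∣) ≡ weight I v * 3 ^ (r + ∣ grow I v ∣)
  3^[1+r+∣I∣]≡weight*3^[r+∣grow∣] r {I} {v} small≡true v∉I rewrite small≡true with touches I v
  ... | true  = refl
  ... | false = begin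
    3 ^ suc (r + ∣ I ∣)                 ≡⟨ cong (3 ^_) (+-suc r ∣ I ∣) ⟨
    3 ^ (r + suc ∣ I ∣)                 ≡⟨ cong (λ s → 3 ^ (r + s)) (∣p[i]≔true∣≡1+∣p∣ I v v∉I) ⟨
    3 ^ (r + ∣ I [ v ]≔ true ∣)         ≡⟨ *-identityˡ _ ⟨
    1 * 3 ^ (r + ∣ I [ v ]≔ true ∣)     ∎
    where open ≡-Reasoning

  BadExtension : ℕ → Subset n → Subset n → Subset n → Set
  BadExtension r P I S = ∣ S ∣ ≡ r × S ⊆ P × (∀ J → J ⊆ I ∪ S → Independent G J → 4 * ∣ J ∣ < k)

  BadExtension-link : ∀ {r P I S} v → BadExtension (suc r) P I S → lookup S v ≡ true →
    BadExtension r (P [ v ]≔ false) (grow I v) (S [ v ]≔ false)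
  BadExtension-link {r} {P} {I} {S} v (∣S∣≡1+r , S⊆P , bad) S∋v =
    suc-injective (trans (1+∣p[i]≔false∣≡∣p∣ S v S∋v) ∣S∣≡1+r) , S-v⊆P-v , bad′
    where
    S-v⊆P-v : S [ v ]≔ false ⊆ P [ v ]≔ false
    S-v⊆P-v x∈ with ∈-[]≔false⁻ x∈
    ... | x≢v , x∈S = []≔-minimal P _ v x≢v (S⊆P x∈S)
    ⊆I∪S : grow I v ∪ (S [ v ]≔ false) ⊆ I ∪ S
    ⊆I∪S {x} x∈ with x∈p∪q⁻ (grow I v) (S [ v ]≔ false) x∈
    ... | inj₂ x∈S-v = x∈p∪q⁺ (inj₂ (proj₂ (∈-[]≔false⁻ x∈S-v)))
    ... | inj₁ x∈grow with grow⊆ x∈grow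
    ...   | inj₁ refl = x∈p∪q⁺ (inj₂ (lookup⇒[]= v S S∋v))
    ...   | inj₂ x∈I  = x∈p∪q⁺ (inj₁ x∈I)
    bad′ : ∀ J → J ⊆ grow I v ∪ (S [ v ]≔ false) → Independent G J → 4 * ∣ J ∣ < k
    bad′ J J⊆ = bad J (⊆I∪S ∘ J⊆)

  ∣L∣*r!*3^[r+∣I∣]≤3^[k/4]*W : ∀ r P I L → Independent G I → (∀ {x} → x ∈ P → x ∉ I) →
    Unique L → All (BadExtension r P I) L → length L * (r ! * 3 ^ (r + ∣ I ∣)) ≤ 3 ^ (k / 4) * W r P I
  ∣L∣*r!*3^[r+∣I∣]≤3^[k/4]*W r P I [] _ _ _ _ = z≤n
  ∣L∣*r!*3^[r+∣I∣]≤3^[k/4]*W zero P I (S ∷ []) indep _ _ ((_ , _ , bad) ∷ []) = begin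
    1 * (1 * 3 ^ ∣ I ∣) ≡⟨ trans (*-identityˡ _) (*-identityˡ _) ⟩
    3 ^ ∣ I ∣           ≤⟨ ^-monoʳ-≤ 3 (4*j<k⇒j≤k/4 {∣ I ∣} (bad I (p⊆p∪q {p = I} S) indep)) ⟩
    3 ^ (k / 4)         ≡⟨ *-identityʳ _ ⟨
    3 ^ (k / 4) * 1     ∎
    where open ≤-Reasoning
  ∣L∣*r!*3^[r+∣I∣]≤3^[k/4]*W zero P I (S ∷ S′ ∷ _) _ _ ((S≢S′ ∷ _) ∷ _) ((∣S∣≡0 , _) ∷ (∣S′∣≡0 , _) ∷ _) =
    contradiction (trans (∣p∣≡0⇒p≡⊥ S ∣S∣≡0) (sym (∣p∣≡0⇒p≡⊥ S′ ∣S′∣≡0))) S≢S′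
  ∣L∣*r!*3^[r+∣I∣]≤3^[k/4]*W (suc r) P I L@(S ∷ _) indep disjoint unique bads@((_ , _ , bad) ∷ _) = begin
    length L * (suc r ! * 3 ^ (suc r + ∣ I ∣))
      ≡⟨ regroup (length L) (suc r) (r !) (3 ^ (suc r + ∣ I ∣)) ⟩
    suc r * length L * Y
      ≡⟨ cong (_* Y) (∑χ*length-link (suc r) P L (All.map (λ ext → proj₁ ext , proj₁ (proj₂ ext)) bads)) ⟨
    ∑[ v < n ] (χ (lookup P v) * length (link v L)) * Y
      ≡⟨ *-distribʳ-sum Y (λ v → χ (lookup P v) * length (link v L)) ⟩
    ∑[ v < n ] (χ (lookup P v) * length (link v L) * Y)
      ≡⟨ sum-cong-≗ (λ v → *-assoc (χ (lookup P v)) (length (link v L)) Y) ⟩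
    ∑[ v < n ] (χ (lookup P v) * (length (link v L) * Y))
      ≤⟨ sum-mono-≤ (λ v → χ*-mono-≤ (lookup P v) (step v)) ⟩
    ∑[ v < n ] (χ (lookup P v) * (3 ^ (k / 4) * (weight I v * W r (P [ v ]≔ false) (grow I v))))
      ≡⟨ sum-cong-≗ (λ v → x∙yz≈y∙xz (χ (lookup P v)) (3 ^ (k / 4)) (weight I v * W r (P [ v ]≔ false) (grow I v))) ⟩
    ∑[ v < n ] (3 ^ (k / 4) * (χ (lookup P v) * (weight I v * W r (P [ v ]≔ false) (grow I v))))
      ≡⟨ *-distribˡ-sum (3 ^ (k / 4)) (λ v → χ (lookup P v) * (weight I v * W r (P [ v ]≔ false) (grow I v))) ⟨
    3 ^ (k / 4) * W (suc r) P I ∎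
    where
    open ≤-Reasoning
    Y = r ! * 3 ^ (suc r + ∣ I ∣)
    regroup : ∀ l s f x → l * (s * f * x) ≡ s * l * (f * x)
    regroup = solve-∀
    step : ∀ v → lookup P v ≡ true →
      length (link v L) * Y ≤ 3 ^ (k / 4) * (weight I v * W r (P [ v ]≔ false) (grow I v))
    step v P∋v = begin
      length (link v L) * (r ! * 3 ^ (suc r + ∣ I ∣))
        ≡⟨ cong (λ x → length (link v L) * (r ! * x))
             (3^[1+r+∣I∣]≡weight*3^[r+∣grow∣] r (4∣I∣<k⇒small {I} (bad I (p⊆p∪q {p = I} S) indep))
               (∉⇒lookup≡false (disjoint (lookup⇒[]= v P P∋v)))) ⟩
      length (link v L) * (r ! * (weight I v * 3 ^ (r + ∣ grow I v ∣)))
        ≡⟨ regroup′ (length (link v L)) (r !) (weight I v) (3 ^ (r + ∣ grow I v ∣)) ⟩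
      weight I v * (length (link v L) * (r ! * 3 ^ (r + ∣ grow I v ∣)))
        ≤⟨ *-monoʳ-≤ (weight I v) (∣L∣*r!*3^[r+∣I∣]≤3^[k/4]*W r (P [ v ]≔ false) (grow I v) (link v L)
             (grow-independent v indep) disjoint′ (Unique-link v unique)
             (All-link v (BadExtension-link v) bads)) ⟩
      weight I v * (3 ^ (k / 4) * W r (P [ v ]≔ false) (grow I v))
        ≡⟨ x∙yz≈y∙xz (weight I v) (3 ^ (k / 4)) _ ⟩
      3 ^ (k / 4) * (weight I v * W r (P [ v ]≔ false) (grow I v)) ∎
      where
      regroup′ : ∀ l f w x → l * (f * (w * x)) ≡ w * (l * (f * x))
      regroup′ = solve-∀
      disjoint′ : ∀ {x} → x ∈ P [ v ]≔ false → x ∉ grow I v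
      disjoint′ x∈ x∈grow with ∈-[]≔false⁻ x∈ | grow⊆ x∈grow
      ... | x≢v , _   | inj₁ x≡v = x≢v x≡v
      ... | _   , x∈P | inj₂ x∈I = disjoint x∈P x∈I

  BadSubset⇒BadExtension : ∀ {S} → BadSubset G k S → BadExtension k ⊤ ⊥ S
  BadSubset⇒BadExtension {S} (∣S∣≡k , ¬indep) = ∣S∣≡k , ⊆⊤ , bad
    where
    J⊆S : ∀ {J} → J ⊆ ⊥ ∪ S → J ⊆ S
    J⊆S J⊆ x∈J with x∈p∪q⁻ ⊥ S (J⊆ x∈J)
    ... | inj₁ x∈⊥ = contradiction x∈⊥ ∉⊥
    ... | inj₂ x∈S = x∈S
    bad : ∀ J → J ⊆ ⊥ ∪ S → Independent G J → 4 * ∣ J ∣ < k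
    bad J J⊆ indep = ≰⇒> (λ k≤4∣J∣ → ¬indep (J , J⊆S J⊆ , indep , k≤4∣J∣))

  ∣L∣*3^k≤3^[k/4]*2^k*nCk : 2 * k ≤ n → (∀ v → k * degree G v ≤ n) →
    ∀ {L} → Unique L → All (BadSubset G k) L → length L * 3 ^ k ≤ 3 ^ (k / 4) * (2 ^ k * (n C k))
  ∣L∣*3^k≤3^[k/4]*2^k*nCk 2k≤n k*deg≤n {L} unique bads = *-cancelˡ-≤ (k !) {{k !≢0}} (begin
    k ! * (length L * 3 ^ k)
      ≡⟨ x∙yz≈y∙xz (k !) (length L) (3 ^ k) ⟩
    length L * (k ! * 3 ^ k)
      ≡⟨ cong (λ s → length L * (k ! * 3 ^ s)) (trans (cong (k +_) (∣⊥∣≡0 n)) (+-identityʳ k)) ⟨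
    length L * (k ! * 3 ^ (k + ∣ ⊥ {n = n} ∣))
      ≤⟨ ∣L∣*r!*3^[r+∣I∣]≤3^[k/4]*W k ⊤ ⊥ L (λ _ _ u∈⊥ → contradiction u∈⊥ ∉⊥) (λ _ → ∉⊥) unique
           (All.map BadSubset⇒BadExtension bads) ⟩
    3 ^ (k / 4) * W k ⊤ ⊥
      ≤⟨ *-monoʳ-≤ (3 ^ (k / 4)) (W≤2^r*r!*∣P∣Cr 2k≤n k*deg≤n k ⊤ ⊥ (≤-reflexive (cong (_+ k) (sym (∣⊤∣≡n n))))) ⟩
    3 ^ (k / 4) * (2 ^ k * (k ! * (∣ ⊤ {n} ∣ C k)))
      ≡⟨ cong (λ p → 3 ^ (k / 4) * (2 ^ k * (k ! * (p C k)))) (∣⊤∣≡n n) ⟩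
    3 ^ (k / 4) * (2 ^ k * (k ! * (n C k)))
      ≡⟨ cong (3 ^ (k / 4) *_) (x∙yz≈y∙xz (2 ^ k) (k !) (n C k)) ⟩
    3 ^ (k / 4) * (k ! * (2 ^ k * (n C k)))
      ≡⟨ x∙yz≈y∙xz (3 ^ (k / 4)) (k !) (2 ^ k * (n C k)) ⟩
    k ! * (3 ^ (k / 4) * (2 ^ k * (n C k))) ∎)
    where open ≤-Reasoning

lemma3p2 : (n k : ℕ) → 1 ≤ k → 2 * k ≤ n → (G : Graph n)
           → (∀ v → k * degree G v ≤ n)
           → (L : List (Subset n)) → Unique L → All (BadSubset G k) L
           → ProbBoundExp (length L) (n C k) k
lemma3p2 n k _ 2k≤n G k*deg≤n L unique bads m =
  cross-multiply-≤ {p = length L ^ 8} {a = (3 ^ k) ^ 6} {b = (2 ^ k) ^ 8} {c = 11 ^ (12 * k)} {d = 12 ^ (12 * k)}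
      {{m*n≢0 _ _ {{m^n≢0 (3 ^ k) 6 {{m^n≢0 3 k}}}} {{m^n≢0 11 (12 * k)}}}}
    counting-bound (expScaled-bound 11 k m) ([2^k]^8*12^[12k]≤[3^k]^6*11^[12k] k)
  where
  open Greedy G k
  counting-bound : length L ^ 8 * (3 ^ k) ^ 6 ≤ (2 ^ k) ^ 8 * (n C k) ^ 8
  counting-bound = eighth-power-≤ (length L) (3 ^ k) (3 ^ (k / 4)) (2 ^ k) (n C k) {{m^n≢0 3 k}} ([a^[k/4]]^4≤a^k 3 k)
    (∣L∣*3^k≤3^[k/4]*2^k*nCk 2k≤n k*deg≤n unique bads)
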